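{- Let $t,u$ be CBN terms and $s'$ a Bang term. 1. (Stability) If $t^{n}\to_S^* s'$, then there is a CBN term $s$ with $s^{n}=s'$. 2. (Normal forms) $t$ is a normal form for CBN surface reduction if and only if $t^{n}$ is a normal form for Bang surface reduction $\to_S$. 3. (Simulations) $t \to_S^* u$ in CBN if and only if $t^{n}\to_S^* u^{n}$ in the Distant Bang Calculus. Moreover, the number of $dB$/$s$-steps on the left matches the number of $dB$/$s!$-steps on the right.
   Context: Distant Bang Calculus. Terms: $t,u,s ::= x \mid t\,u \mid \lambda x.t \mid !t \mid \mathrm{der}(t) \mid t[x\backslash u]$; $\lambda x.t$ and $t[x\backslash u]$ bind $x$ in $t$; terms up to $\alpha$-conversion; $t\{x:=u\}$ is capture-avoiding substitution. Contexts have exactly one hole $\square$, $C\langle t\rangle$ is plugging. Surface contexts: $S ::= \square \mid S\,t \mid t\,S \mid \lambda x.S \mid \mathrm{der}(S) \mid S[x\backslash t] \mid t[x\backslash S]$; list contexts $L ::= \square \mid L[x\backslash t]$. Rules (capture-free w.r.t. $L$): $(dB)$ $L\langle \lambda x.t\rangle\,u \mapsto L\langle t[x\backslash u]\rangle$; $(s!)$ $t[x\backslash L\langle !u\rangle] \mapsto L\langle t\{x:=u\}\rangle$; $(d!)$ $\mathrm{der}(L\langle !t\rangle) \mapsto L\langle t\rangle$. Surface reduction $\to_S$: $S\langle t\rangle\to_S S\langle u\rangle$ for any surface context $S$ and $t\mapsto_R u$, $R\in\{dB,s!,d!\}$. CBN calculus. Terms $t,u ::= x \mid \lambda x.t \mid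 t\,u \mid t[x\backslash u]$; list contexts $L ::= \square \mid L[x\backslash t]$; surface contexts $N ::= \square \mid N\,t \mid \lambda x.N \mid N[x\backslash t]$. Rules: $(dB)$ $L\langle \lambda x.t\rangle\,u \mapsto L\langle t[x\backslash u]\rangle$ (capture-free), $(s)$ $t[x\backslash u]\mapsto t\{x:=u\}$. CBN surface reduction $\to_S$: closure of $dB$ and $s$ under CBN surface contexts. CBN embedding $(\cdot)^n$: $x^n=x$, $(\lambda x.t)^n=\lambda x.t^n$, $(t\,u)^n=t^n\,!u^n$, $(t[x\backslash u])^n=t^n[x\backslash !u^n]$. -}

module Defs where

open import Data.Nat using (ℕ; zero; suc)
open import Data.Fin using (Fin; zero; suc)
open import Data.Product using (∃)
open import Relation.Nullary using (¬_)

-- Terms are well-scoped de Bruijn terms: a term of type  X n  has at most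
-- n free variables (Fin n).  Alpha-equivalence is thus syntactic equality.

Ren : ℕ → ℕ → Set
Ren n m = Fin n → Fin m

ext : ∀ {n m} → Ren n m → Ren (suc n) (suc m)
ext ρ zero    = zero
ext ρ (suc i) = suc (ρ i)

data BTm (n : ℕ) : Set where
  var  : Fin n → BTm n
  app  : BTm n → BTm n → BTm n
  lam  : BTm (suc n) → BTm n
  bang : BTm n → BTm n
  der  : BTm n → BTm n
  es   : BTm (suc n) → BTm n → BTm n   -- t[x\u]  (x bound in t)

renB : ∀ {n m} → Ren n m → BTm n → BTm m
renB ρ (var i)   = var (ρ i)
renB ρ (app t u) = app (renB ρ t) (renB ρ u)
renB ρ (lam t)   = lam (renB (ext ρ) t)
renB ρ (bang t)  = bang (renB ρ t)
renB ρ (der t)   = der (renB ρ t)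
renB ρ (es t u)  = es (renB (ext ρ) t) (renB ρ u)

extsB : ∀ {n m} → (Fin n → BTm m) → Fin (suc n) → BTm (suc m)
extsB σ zero    = var zero
extsB σ (suc i) = renB suc (σ i)

subB : ∀ {n m} → (Fin n → BTm m) → BTm n → BTm m
subB σ (var i)   = σ i
subB σ (app t u) = app (subB σ t) (subB σ u)
subB σ (lam t)   = lam (subB (extsB σ) t)
subB σ (bang t)  = bang (subB σ t)
subB σ (der t)   = der (subB σ t)
subB σ (es t u)  = es (subB (extsB σ) t) (subB σ u)

sub0B : ∀ {n} → BTm (suc n) → BTm n → BTm n
sub0B {n} t u = subB σ t
  where
  σ : Fin (suc n) → BTm n
  σ zero    = u
  σ (suc i) = var i

-- list contexts L ::= □ | L[x\t] ; LCtxB n m : outer scope n, scope at hole m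
data LCtxB : ℕ → ℕ → Set where
  hole : ∀ {n} → LCtxB n n
  _[≔_] : ∀ {n m} → LCtxB (suc n) m → BTm n → LCtxB n m

plugLB : ∀ {n m} → LCtxB n m → BTm m → BTm n
plugLB hole       s = s
plugLB (L [≔ t ]) s = es (plugLB L s) t

-- weakening from the outer scope of L into the scope of its hole
-- (this implements the "capture-free" side condition)
wkLB : ∀ {n m} → LCtxB n m → Ren n m
wkLB hole       = λ i → i
wkLB (L [≔ t ]) = λ i → wkLB L (suc i)

data BRule : Set where
  dB s! d! : BRule

data _↦B[_]_ {n : ℕ} : BTm n → BRule → BTm n → Set where
  dB : ∀ {m} (L : LCtxB n m) (t : BTm (suc m)) (u : BTm n) →
       app (plugLB L (lam t)) u ↦B[ dB ] plugLB L (es t (renB (wkLB L) u))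
  s! : ∀ {m} (t : BTm (suc n)) (L : LCtxB n m) (u : BTm m) →
       es t (plugLB L (bang u)) ↦B[ s! ] plugLB L (sub0B (renB (ext (wkLB L)) t) u)
  d! : ∀ {m} (L : LCtxB n m) (t : BTm m) →
       der (plugLB L (bang t)) ↦B[ d! ] plugLB L t

data _⟶B[_]_ : {n : ℕ} → BTm n → BRule → BTm n → Set where
  root  : ∀ {n r} {t u : BTm n} → t ↦B[ r ] u → t ⟶B[ r ] u
  appL  : ∀ {n r} {t t' : BTm n} (u : BTm n) → t ⟶B[ r ] t' → app t u ⟶B[ r ] app t' u
  appR  : ∀ {n r} (t : BTm n) {u u' : BTm n} → u ⟶B[ r ] u' → app t u ⟶B[ r ] app t u'
  lamS  : ∀ {n r} {t t' : BTm (suc n)} → t ⟶B[ r ] t' → lam t ⟶B[ r ] lam t'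
  derS  : ∀ {n r} {t t' : BTm n} → t ⟶B[ r ] t' → der t ⟶B[ r ] der t'
  esL   : ∀ {n r} {t t' : BTm (suc n)} (u : BTm n) → t ⟶B[ r ] t' → es t u ⟶B[ r ] es t' u
  esR   : ∀ {n r} (t : BTm (suc n)) {u u' : BTm n} → u ⟶B[ r ] u' → es t u ⟶B[ r ] es t u'

_⟶B_ : ∀ {n} → BTm n → BTm n → Set
t ⟶B u = ∃ λ r → t ⟶B[ r ] u

data BSteps {n : ℕ} : ℕ → ℕ → BTm n → BTm n → Set where
  done : ∀ {t} → BSteps 0 0 t t
  viaDB : ∀ {k m t t' u} → t ⟶B[ dB ] t' → BSteps k m t' u → BSteps (suc k) m t u
  viaS! : ∀ {k m t t' u} → t ⟶B[ s! ] t' → BSteps k m t' u → BSteps k (suc m) t u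
  viaD! : ∀ {k m t t' u} → t ⟶B[ d! ] t' → BSteps k m t' u → BSteps k m t u

data CTm (n : ℕ) : Set where
  var : Fin n → CTm n
  lam : CTm (suc n) → CTm n
  app : CTm n → CTm n → CTm n
  es  : CTm (suc n) → CTm n → CTm n

renC : ∀ {n m} → Ren n m → CTm n → CTm m
renC ρ (var i)   = var (ρ i)
renC ρ (lam t)   = lam (renC (ext ρ) t)
renC ρ (app t u) = app (renC ρ t) (renC ρ u)
renC ρ (es t u)  = es (renC (ext ρ) t) (renC ρ u)

extsC : ∀ {n m} → (Fin n → CTm m) → Fin (suc n) → CTm (suc m)
extsC σ zero    = var zero
extsC σ (suc i) = renC suc (σ i)

subC : ∀ {n m} → (Fin n → CTm m) → CTm n → CTm m
subC σ (var i)   = σ i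
subC σ (lam t)   = lam (subC (extsC σ) t)
subC σ (app t u) = app (subC σ t) (subC σ u)
subC σ (es t u)  = es (subC (extsC σ) t) (subC σ u)

sub0C : ∀ {n} → CTm (suc n) → CTm n → CTm n
sub0C {n} t u = subC σ t
  where
  σ : Fin (suc n) → CTm n
  σ zero    = u
  σ (suc i) = var i

data LCtxC : ℕ → ℕ → Set where
  hole : ∀ {n} → LCtxC n n
  _[≔_] : ∀ {n m} → LCtxC (suc n) m → CTm n → LCtxC n m

plugLC : ∀ {n m} → LCtxC n m → CTm m → CTm n
plugLC hole       s = s
plugLC (L [≔ t ]) s = es (plugLC L s) t

wkLC : ∀ {n m} → LCtxC n m → Ren n m
wkLC hole       = λ i → i
wkLC (L [≔ t ]) = λ i → wkLC L (suc i)

data CRule : Set where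
  dB s : CRule

data _↦C[_]_ {n : ℕ} : CTm n → CRule → CTm n → Set where
  dB : ∀ {m} (L : LCtxC n m) (t : CTm (suc m)) (u : CTm n) →
       app (plugLC L (lam t)) u ↦C[ dB ] plugLC L (es t (renC (wkLC L) u))
  s  : (t : CTm (suc n)) (u : CTm n) → es t u ↦C[ s ] sub0C t u

data _⟶C[_]_ : {n : ℕ} → CTm n → CRule → CTm n → Set where
  root : ∀ {n r} {t u : CTm n} → t ↦C[ r ] u → t ⟶C[ r ] u
  appL : ∀ {n r} {t t' : CTm n} (u : CTm n) → t ⟶C[ r ] t' → app t u ⟶C[ r ] app t' u
  lamS : ∀ {n r} {t t' : CTm (suc n)} → t ⟶C[ r ] t' → lam t ⟶C[ r ] lam t'
  esL  : ∀ {n r} {t t' : CTm (suc n)} (u : CTm n) → t ⟶C[ r ] t' → es t u ⟶C[ r ] es t' u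

_⟶C_ : ∀ {n} → CTm n → CTm n → Set
t ⟶C u = ∃ λ r → t ⟶C[ r ] u

data CSteps {n : ℕ} : ℕ → ℕ → CTm n → CTm n → Set where
  done : ∀ {t} → CSteps 0 0 t t
  viaDB : ∀ {k m t t' u} → t ⟶C[ dB ] t' → CSteps k m t' u → CSteps (suc k) m t u
  viaS  : ∀ {k m t t' u} → t ⟶C[ s ] t' → CSteps k m t' u → CSteps k (suc m) t u

NF : ∀ {A : Set} → (A → A → Set) → A → Set
NF R t = ∀ u → ¬ R t u

_ⁿ : ∀ {n} → CTm n → BTm n
var x ⁿ   = var x
lam t ⁿ   = lam (t ⁿ)
app t u ⁿ = app (t ⁿ) (bang (u ⁿ))
es t u ⁿ  = es (t ⁿ) (bang (u ⁿ))

module Submission where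

open import Defs
open import Data.Nat using (ℕ; suc)
open import Data.Fin using (Fin; zero; suc)
open import Data.Maybe using (Maybe; just; nothing; zipWith)
import Data.Maybe as Maybe
open import Data.Maybe.Properties using (just-injective)
open import Data.Product using (∃; _×_; Σ; _,_)
open import Data.Empty using (⊥-elim)
open import Relation.Nullary using (¬_)
open import Function.Bundles using (_⇔_; mk⇔)
open import Relation.Binary.PropositionalEquality
  using (_≡_; refl; sym; trans; cong; cong₂; subst; subst₂; module ≡-Reasoning)
open import Relation.Binary.Construct.Closure.ReflexiveTransitive using (Star; ε; _◅_; gmap)

-- The embedding is a strict simulation, mapping dB to dB and s to s! with
-- the empty list context.  Conversely its image is closed under surface
-- reduction and every step from an image term is the image of a CBN step:
-- arguments and substituted terms of t ⁿ are boxed by !, which blocks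
-- surface reduction, and der never occurs in t ⁿ, so no d!-step is possible.
-- Since ⁿ is injective, the simulations also transport reduction sequences
-- back, with the same numbers of dB- and s-steps.

private
  variable
    n m : ℕ

renB-ⁿ : (ρ : Ren n m) (t : CTm n) → renB ρ (t ⁿ) ≡ renC ρ t ⁿ
renB-ⁿ ρ (var x)   = refl
renB-ⁿ ρ (lam t)   = cong lam (renB-ⁿ (ext ρ) t)
renB-ⁿ ρ (app t u) = cong₂ app (renB-ⁿ ρ t) (cong bang (renB-ⁿ ρ u))
renB-ⁿ ρ (es t u)  = cong₂ es (renB-ⁿ (ext ρ) t) (cong bang (renB-ⁿ ρ u))

extsB-ⁿ : {σ : Fin n → BTm m} {τ : Fin n → CTm m} →
          (∀ i → σ i ≡ τ i ⁿ) → ∀ i → extsB σ i ≡ extsC τ i ⁿ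
extsB-ⁿ σ≡τ zero    = refl
extsB-ⁿ σ≡τ (suc i) = trans (cong (renB suc) (σ≡τ i)) (renB-ⁿ suc _)

subB-ⁿ : {σ : Fin n → BTm m} {τ : Fin n → CTm m} →
         (∀ i → σ i ≡ τ i ⁿ) → (t : CTm n) → subB σ (t ⁿ) ≡ subC τ t ⁿ
subB-ⁿ σ≡τ (var x)   = σ≡τ x
subB-ⁿ σ≡τ (lam t)   = cong lam (subB-ⁿ (extsB-ⁿ σ≡τ) t)
subB-ⁿ σ≡τ (app t u) = cong₂ app (subB-ⁿ σ≡τ t) (cong bang (subB-ⁿ σ≡τ u))
subB-ⁿ σ≡τ (es t u)  = cong₂ es (subB-ⁿ (extsB-ⁿ σ≡τ) t) (cong bang (subB-ⁿ σ≡τ u))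

sub0B-ⁿ : (t : CTm (suc n)) (u : CTm n) → sub0B (t ⁿ) (u ⁿ) ≡ sub0C t u ⁿ
sub0B-ⁿ t u = subB-ⁿ (λ { zero → refl ; (suc i) → refl }) t

ext-id : {ρ : Ren n n} → (∀ i → ρ i ≡ i) → ∀ i → ext ρ i ≡ i
ext-id ρ≡id zero    = refl
ext-id ρ≡id (suc i) = cong suc (ρ≡id i)

renB-id : {ρ : Ren n n} → (∀ i → ρ i ≡ i) → (t : BTm n) → renB ρ t ≡ t
renB-id ρ≡id (var x)   = cong var (ρ≡id x)
renB-id ρ≡id (app t u) = cong₂ app (renB-id ρ≡id t) (renB-id ρ≡id u)
renB-id ρ≡id (lam t)   = cong lam (renB-id (ext-id ρ≡id) t)
renB-id ρ≡id (bang t)  = cong bang (renB-id ρ≡id t)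
renB-id ρ≡id (der t)   = cong der (renB-id ρ≡id t)
renB-id ρ≡id (es t u)  = cong₂ es (renB-id (ext-id ρ≡id) t) (renB-id ρ≡id u)

decode : BTm n → Maybe (CTm n)
decode (var x)          = just (var x)
decode (lam t)          = Maybe.map lam (decode t)
decode (app t (bang u)) = zipWith app (decode t) (decode u)
decode (es t (bang u))  = zipWith es (decode t) (decode u)
decode _                = nothing

decode-ⁿ : (t : CTm n) → decode (t ⁿ) ≡ just t
decode-ⁿ (var x) = refl
decode-ⁿ (lam t) rewrite decode-ⁿ t = refl
decode-ⁿ (app t u) rewrite decode-ⁿ t | decode-ⁿ u = refl
decode-ⁿ (es t u) rewrite decode-ⁿ t | decode-ⁿ u = refl

ⁿ-injective : {t u : CTm n} → t ⁿ ≡ u ⁿ → t ≡ u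
ⁿ-injective {t = t} {u} tⁿ≡uⁿ =
  just-injective (trans (sym (decode-ⁿ t)) (trans (cong decode tⁿ≡uⁿ) (decode-ⁿ u)))

_ⁿᴸ : LCtxC n m → LCtxB n m
hole ⁿᴸ       = hole
(K [≔ t ]) ⁿᴸ = (K ⁿᴸ) [≔ bang (t ⁿ) ]

plugLB-ⁿ : (K : LCtxC n m) (v : CTm m) → plugLB (K ⁿᴸ) (v ⁿ) ≡ plugLC K v ⁿ
plugLB-ⁿ hole       v = refl
plugLB-ⁿ (K [≔ t ]) v = cong (λ a → es a (bang (t ⁿ))) (plugLB-ⁿ K v)

wkLB-ⁿ : (K : LCtxC n m) → wkLB (K ⁿᴸ) ≡ wkLC K
wkLB-ⁿ hole       = refl
wkLB-ⁿ (K [≔ t ]) = cong (λ ρ i → ρ (suc i)) (wkLB-ⁿ K)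

es-injective : {a c : BTm (suc n)} {b d : BTm n} → es a b ≡ es c d → a ≡ c × b ≡ d
es-injective refl = refl , refl

plugLB-inverse : (L : LCtxB n m) (x : BTm m) (t : CTm n) → plugLB L x ≡ t ⁿ →
  Σ (LCtxC n m) λ K → Σ (CTm m) λ v → L ≡ K ⁿᴸ × x ≡ v ⁿ × t ≡ plugLC K v
plugLB-inverse hole       x t        x≡tⁿ = hole , t , refl , x≡tⁿ , refl
plugLB-inverse (L [≔ _ ]) x (var _)  ()
plugLB-inverse (L [≔ _ ]) x (lam _)  ()
plugLB-inverse (L [≔ _ ]) x (app _ _) ()
plugLB-inverse (L [≔ _ ]) x (es t u) e with es-injective e
... | plug≡tⁿ , refl with plugLB-inverse L x t plug≡tⁿ
...   | K , v , refl , x≡vⁿ , refl = K [≔ u ] , v , refl , x≡vⁿ , refl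

dB-contractum-ⁿ : (K : LCtxC n m) (t : CTm (suc m)) (u : CTm n) →
  plugLB (K ⁿᴸ) (es (t ⁿ) (renB (wkLB (K ⁿᴸ)) (bang (u ⁿ))))
    ≡ plugLC K (es t (renC (wkLC K) u)) ⁿ
dB-contractum-ⁿ K t u = begin
  plugLB (K ⁿᴸ) (es (t ⁿ) (bang (renB (wkLB (K ⁿᴸ)) (u ⁿ))))
    ≡⟨ cong (λ ρ → plugLB (K ⁿᴸ) (es (t ⁿ) (bang (renB ρ (u ⁿ))))) (wkLB-ⁿ K) ⟩
  plugLB (K ⁿᴸ) (es (t ⁿ) (bang (renB (wkLC K) (u ⁿ))))
    ≡⟨ cong (λ a → plugLB (K ⁿᴸ) (es (t ⁿ) (bang a))) (renB-ⁿ (wkLC K) u) ⟩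
  plugLB (K ⁿᴸ) (es t (renC (wkLC K) u) ⁿ)
    ≡⟨ plugLB-ⁿ K (es t (renC (wkLC K) u)) ⟩
  plugLC K (es t (renC (wkLC K) u)) ⁿ
    ∎
  where open ≡-Reasoning

s!-contractum-ⁿ : (t : CTm (suc n)) (u : CTm n) →
  sub0B (renB (ext (λ i → i)) (t ⁿ)) (u ⁿ) ≡ sub0C t u ⁿ
s!-contractum-ⁿ t u =
  trans (cong (λ a → sub0B a (u ⁿ)) (renB-id (ext-id λ _ → refl) (t ⁿ))) (sub0B-ⁿ t u)

ruleⁿ : CRule → BRule
ruleⁿ dB = dB
ruleⁿ s  = s!

↦C⇒↦B : ∀ {r} {t u : CTm n} → t ↦C[ r ] u → (t ⁿ) ↦B[ ruleⁿ r ] (u ⁿ)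
↦C⇒↦B (dB K t u) =
  subst₂ (λ a b → app a (bang (u ⁿ)) ↦B[ dB ] b)
    (plugLB-ⁿ K (lam t)) (dB-contractum-ⁿ K t u) (dB (K ⁿᴸ) (t ⁿ) (bang (u ⁿ)))
↦C⇒↦B (s t u) = subst (es (t ⁿ) (bang (u ⁿ)) ↦B[ s! ]_) (s!-contractum-ⁿ t u) (s! (t ⁿ) hole (u ⁿ))

⟶C⇒⟶B : ∀ {n r} {t u : CTm n} → t ⟶C[ r ] u → (t ⁿ) ⟶B[ ruleⁿ r ] (u ⁿ)
⟶C⇒⟶B (root ρ)     = root (↦C⇒↦B ρ)
⟶C⇒⟶B (appL u st) = appL (bang (u ⁿ)) (⟶C⇒⟶B st)
⟶C⇒⟶B (lamS st)   = lamS (⟶C⇒⟶B st)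
⟶C⇒⟶B (esL u st)  = esL (bang (u ⁿ)) (⟶C⇒⟶B st)

data Reflects (t : CTm n) : BRule → BTm n → Set where
  dB : ∀ {u} → t ⟶C[ dB ] u → Reflects t dB (u ⁿ)
  s! : ∀ {u} → t ⟶C[ s ] u → Reflects t s! (u ⁿ)

Reflects⇒⟶C : ∀ {r} {t : CTm n} {b} → Reflects t r b → ∃ λ u → b ≡ u ⁿ × t ⟶C u
Reflects⇒⟶C (dB st) = _ , refl , dB , st
Reflects⇒⟶C (s! st) = _ , refl , s , st

bang-irreducible : ∀ {n r} {a b : BTm n} → ¬ (bang a ⟶B[ r ] b)
bang-irreducible (root ())

-- The hypotheses on the function position and on the substituted term are
-- kept as equations, since unifying plugLB L x with t ⁿ would get stuck.
↦B-reflect-app : ∀ {r} {t u : CTm n} {a b} → app a (bang (u ⁿ)) ↦B[ r ] b → a ≡ t ⁿ →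
                 Reflects (app t u) r b
↦B-reflect-app {t = t} {u} (dB L y _) a≡tⁿ with plugLB-inverse L (lam y) t a≡tⁿ
... | K , lam y′ , refl , refl , refl =
  subst (Reflects _ dB) (sym (dB-contractum-ⁿ K y′ u)) (dB (root (dB K y′ u)))
... | K , var _   , _ , () , _
... | K , app _ _ , _ , () , _
... | K , es _ _  , _ , () , _

↦B-reflect-es : ∀ {r} {t : CTm (suc n)} {u : CTm n} {a b} → es (t ⁿ) a ↦B[ r ] b → a ≡ bang (u ⁿ) →
                Reflects (es t u) r b
↦B-reflect-es {t = t} {u} (s! _ hole _) refl =
  subst (Reflects _ s!) (sym (s!-contractum-ⁿ t u)) (s! (root (s t u)))
↦B-reflect-es (s! _ (_ [≔ _ ]) _) ()

⟶B-reflect : ∀ {n r} (t : CTm n) {b} → (t ⁿ) ⟶B[ r ] b → Reflects t r b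
⟶B-reflect (var _)   (root ())
⟶B-reflect (lam _)   (root ())
⟶B-reflect (lam t)   (lamS st) with ⟶B-reflect t st
... | dB st′ = dB (lamS st′)
... | s! st′ = s! (lamS st′)
⟶B-reflect (app _ _) (root ρ) = ↦B-reflect-app ρ refl
⟶B-reflect (app t u) (appL _ st) with ⟶B-reflect t st
... | dB st′ = dB (appL u st′)
... | s! st′ = s! (appL u st′)
⟶B-reflect (app _ _) (appR _ st) = ⊥-elim (bang-irreducible st)
⟶B-reflect (es _ _)  (root ρ) = ↦B-reflect-es ρ refl
⟶B-reflect (es t u)  (esL _ st) with ⟶B-reflect t st
... | dB st′ = dB (esL u st′)
... | s! st′ = s! (esL u st′)
⟶B-reflect (es _ _)  (esR _ st) = ⊥-elim (bang-irreducible st)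

⟶B*-lift : (t : CTm n) {b : BTm n} → Star _⟶B_ (t ⁿ) b → ∃ λ v → v ⁿ ≡ b × Star _⟶C_ t v
⟶B*-lift t ε = t , refl , ε
⟶B*-lift t ((_ , st) ◅ sts) with Reflects⇒⟶C (⟶B-reflect t st)
... | u , refl , t⟶u with ⟶B*-lift u sts
...   | v , vⁿ≡b , u⟶*v = v , vⁿ≡b , t⟶u ◅ u⟶*v

BSteps-lift : ∀ {k m} (t : CTm n) {b : BTm n} → BSteps k m (t ⁿ) b →
              ∃ λ v → v ⁿ ≡ b × CSteps k m t v
BSteps-lift t done = t , refl , done
BSteps-lift t (viaDB st sts) with ⟶B-reflect t st
... | dB {u} t⟶u with BSteps-lift u sts
...   | v , vⁿ≡b , u⟶*v = v , vⁿ≡b , viaDB t⟶u u⟶*v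
BSteps-lift t (viaS! st sts) with ⟶B-reflect t st
... | s! {u} t⟶u with BSteps-lift u sts
...   | v , vⁿ≡b , u⟶*v = v , vⁿ≡b , viaS t⟶u u⟶*v
BSteps-lift t (viaD! st sts) with ⟶B-reflect t st
... | ()

CSteps⇒BSteps : ∀ {k m} {t u : CTm n} → CSteps k m t u → BSteps k m (t ⁿ) (u ⁿ)
CSteps⇒BSteps done            = done
CSteps⇒BSteps (viaDB st sts) = viaDB (⟶C⇒⟶B st) (CSteps⇒BSteps sts)
CSteps⇒BSteps (viaS st sts)  = viaS! (⟶C⇒⟶B st) (CSteps⇒BSteps sts)

stability : (t : CTm n) {s′ : BTm n} → Star _⟶B_ (t ⁿ) s′ → ∃ λ v → v ⁿ ≡ s′
stability t sts with ⟶B*-lift t sts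
... | v , vⁿ≡s′ , _ = v , vⁿ≡s′

NF-ⁿ : (t : CTm n) → NF _⟶C_ t ⇔ NF _⟶B_ (t ⁿ)
NF-ⁿ t = mk⇔
  (λ nf b (_ , st) → let u , _ , t⟶u = Reflects⇒⟶C (⟶B-reflect t st) in nf u t⟶u)
  (λ nf u (r , st) → nf (u ⁿ) (ruleⁿ r , ⟶C⇒⟶B st))

⟶*-ⁿ : (t u : CTm n) → Star _⟶C_ t u ⇔ Star _⟶B_ (t ⁿ) (u ⁿ)
⟶*-ⁿ t u = mk⇔ (gmap _ⁿ λ (r , st) → ruleⁿ r , ⟶C⇒⟶B st) reflect
  where
  reflect : Star _⟶B_ (t ⁿ) (u ⁿ) → Star _⟶C_ t u
  reflect sts with ⟶B*-lift t sts
  ... | v , vⁿ≡uⁿ , t⟶*v = subst (Star _⟶C_ t) (ⁿ-injective vⁿ≡uⁿ) t⟶*v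

Steps-ⁿ : (t u : CTm n) (k m : ℕ) → CSteps k m t u ⇔ BSteps k m (t ⁿ) (u ⁿ)
Steps-ⁿ t u k m = mk⇔ CSteps⇒BSteps reflect
  where
  reflect : BSteps k m (t ⁿ) (u ⁿ) → CSteps k m t u
  reflect sts with BSteps-lift t sts
  ... | v , vⁿ≡uⁿ , t⟶*v = subst (CSteps k m t) (ⁿ-injective vⁿ≡uⁿ) t⟶*v

corollary2 : ∀ {n : ℕ} (t u : CTm n) (s' : BTm n) →
    (Star _⟶B_ (t ⁿ) s' → ∃ λ (s : CTm n) → s ⁿ ≡ s')
    × (NF _⟶C_ t ⇔ NF _⟶B_ (t ⁿ))
    × (Star _⟶C_ t u ⇔ Star _⟶B_ (t ⁿ) (u ⁿ))
    × (∀ (k m : ℕ) → CSteps k m t u ⇔ BSteps k m (t ⁿ) (u ⁿ))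
corollary2 t u s' = stability t , NF-ⁿ t , ⟶*-ⁿ t u , Steps-ⁿ t u
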